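{- The ordinary generating function, with respect to length, of the set $\mathcal{H}$ is $$B(x)=\frac{1-x^3-\sqrt{x^6-2x^3-4x^2+1}}{2x^2},$$ where the square root is the formal power series with constant term $1$.
   Context: A Dyck path with air pockets (DAP) is a nonempty lattice path starting at $(0,0)$, ending on the $x$-axis, never going below the $x$-axis, consisting of up-steps $U=(1,1)$ and down-steps $D_k=(1,-k)$ with $k\ge 1$, such that no two down-steps are consecutive; $D$ denotes $D_1$. A DAP is prime if it ends with a step $D_k$ with $k\ge 2$ and touches the $x$-axis only at its endpoints; let $\mathcal{P}$ be the set of prime DAP. The lowering $\alpha^\flat$ of a prime DAP $\alpha=U\beta' UD_k$ ($k\ge 2$) is the DAP $\beta' UD_{k-1}$. For a path $\gamma$, $h(\gamma)$ denotes the maximal ordinate reached by $\gamma$ ($h(\varepsilon)=0$). The set $\mathcal{H}$ is defined recursively as the union of the empty path and all DAP $\gamma$ whose first return decomposition $\gamma=\alpha\beta$ (where $\alpha$ is the prefix of $\gamma$ up to its first return to the $x$-axis, so $\alpha\in\mathcal{P}\cup\{UD\}$) satisfies: $\alpha^\flat\in\mathcal{H}$ whenever $\alpha\neq UD$, $\beta\in\mathcal{H}$, and $h(\alpha)\ge h(\beta)$. The length of a path is its number of steps. -}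

module Defs where

open import Data.Nat using (ℕ; zero; suc; _∸_; _≤_; _⊔_)
open import Data.Integer as ℤ using (ℤ)
open import Data.List using (List; []; _∷_; _++_; map; foldr; upTo; length)
open import Data.Product using (Σ; ∃; _×_)
open import Data.Sum using (_⊎_)
open import Relation.Binary.PropositionalEquality using (_≡_; _≢_)
open import Relation.Nullary using (¬_)

-- Steps.  'U' is the up-step (1,1); 'down m' is the down-step D_{m+1} = (1,-(m+1)).
-- So D = D_1 = down 0, and every D_k with k ≥ 1 is represented exactly once.
data Step : Set where
  U    : Step
  down : ℕ → Step

data Walk : ℕ → List Step → ℕ → Set where
  nil : ∀ {h} → Walk h [] h
  up  : ∀ {h h' p} → Walk (suc h) p h' → Walk h (U ∷ p) h'
  dn  : ∀ {h h' p} m → suc m ≤ h → Walk (h ∸ suc m) p h' → Walk h (down m ∷ p) h'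

data NoDD : List Step → Set where
  nd-nil  : NoDD []
  nd-one  : ∀ s → NoDD (s ∷ [])
  nd-U    : ∀ {s p} → NoDD (s ∷ p) → NoDD (U ∷ s ∷ p)
  nd-downU : ∀ {m p} → NoDD (U ∷ p) → NoDD (down m ∷ U ∷ p)

DAP : List Step → Set
DAP p = (p ≢ []) × Walk 0 p 0 × NoDD p

OnlyEndTouches : List Step → Set
OnlyEndTouches α = ∀ p q → α ≡ p ++ q → p ≢ [] → q ≢ [] → ¬ Walk 0 p 0

FirstReturn : List Step → Set
FirstReturn α = (α ≢ []) × Walk 0 α 0 × OnlyEndTouches α

Prime : List Step → Set
Prime α = DAP α × OnlyEndTouches α × ∃ λ m → ∃ λ α' → α ≡ α' ++ (down (suc m) ∷ [])

UD : List Step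
UD = U ∷ down 0 ∷ []

-- Lowering: U β' U D_k  ↦  β' U D_{k-1}  (only meaningful on prime DAP).
lowerLast : List Step → List Step
lowerLast []                       = []
lowerLast (down (suc m) ∷ [])      = down m ∷ []
lowerLast (x ∷ xs)                 = x ∷ lowerLast xs

lower : List Step → List Step
lower (U ∷ rest) = lowerLast rest
lower p          = p

maxFrom : ℕ → List Step → ℕ
maxFrom h []           = h
maxFrom h (U ∷ p)      = h ⊔ maxFrom (suc h) p
maxFrom h (down m ∷ p) = h ⊔ maxFrom (h ∸ suc m) p

ht : List Step → ℕ
ht = maxFrom 0

data H : List Step → Set where
  empty : H []
  node  : ∀ α β → DAP (α ++ β) → FirstReturn α →
          (α ≡ UD ⊎ (Prime α × H (lower α))) →
          H β → ht β ≤ ht α → H (α ++ β)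

Series : Set
Series = ℕ → ℤ

_⊛_ : Series → Series → Series
(f ⊛ g) n = foldr ℤ._+_ (ℤ.+ 0) (map (λ i → f i ℤ.* g (n ∸ i)) (upTo (suc n)))

disc : Series
disc 0 = ℤ.+ 1
disc 2 = ℤ.- (ℤ.+ 4)
disc 3 = ℤ.- (ℤ.+ 2)
disc 6 = ℤ.+ 1
disc _ = ℤ.+ 0

oneMinusX3 : Series
oneMinusX3 0 = ℤ.+ 1
oneMinusX3 3 = ℤ.- (ℤ.+ 1)
oneMinusX3 _ = ℤ.+ 0

numer : Series → Series
numer S n = oneMinusX3 n ℤ.- S n

module Submission where

-- Let F g be the generating function of the paths of H of height at most g.  Splitting γ = αβ at its
-- first return, with h(β) ≤ h(α), gives F (g+1) = F g + A g · F (g+1), where A g counts the arches α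
-- (first-return prefixes allowed in H) of height g+1.  The only arch of height 1 is UD, so A 0 = x²,
-- and lowering α ↦ α♭ is a bijection from arches of height g+2 onto the paths of H of height exactly
-- g+1, so A (g+1) = x (F (g+1) − F g).  By induction this recurrence yields
-- F (g+1) · (1 − x³ − x² F (g−1)) = 1; the coefficients of F g stabilise to those of B, hence
-- B (1 − x³ − x² B) = 1.  So 2x²B is a root of Y² − 2(1 − x³) Y + 4x², as is 1 − x³ − S, and a root
-- with zero constant term is unique because the other factor has constant term −2 ≠ 0.

module PowerSeries where

  open import Defs using (Series; _⊛_)
  open import Algebra.Bundles using (CommutativeRing)
  open import Algebra.Structures using (IsCommutativeRing)
  import Algebra.Solver.Ring
  open import Algebra.Solver.Ring.AlmostCommutativeRing
    using (AlmostCommutativeRing; _-Raw-AlmostCommutative⟶_; fromCommutativeRing)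
  open import Data.Empty using (⊥-elim)
  open import Data.Nat as ℕ using (ℕ; zero; suc; _∸_; _<_; _≤_; z≤n; s≤s)
  import Data.Nat.Properties as ℕ
  open import Data.Integer as ℤ using (ℤ; _+_; _*_; -_; 0ℤ; 1ℤ)
  open import Data.Integer.Properties
  open import Data.Integer.Tactic.RingSolver using (solve-∀)
  open import Data.List using (map; foldr; applyUpTo)
  open import Data.Maybe using (Maybe; just; nothing)
  open import Data.Product using (_,_)
  open import Data.Sum using (inj₁; inj₂)
  open import Function using (_∘_)
  open import Level using (0ℓ)
  open import Relation.Binary.PropositionalEquality
  open import Relation.Nullary using (yes; no)
  open ≡-Reasoning

  ∑ : ℕ → (ℕ → ℤ) → ℤ
  ∑ zero    f = 0ℤ
  ∑ (suc n) f = f 0 + ∑ n (f ∘ suc)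

  ∑-cong : ∀ n {f g : ℕ → ℤ} → (∀ i → i < n → f i ≡ g i) → ∑ n f ≡ ∑ n g
  ∑-cong zero    f≡g = refl
  ∑-cong (suc n) f≡g = cong₂ _+_ (f≡g 0 (s≤s z≤n)) (∑-cong n (λ i i<n → f≡g (suc i) (s≤s i<n)))

  ∑-zero : ∀ n {f : ℕ → ℤ} → (∀ i → i < n → f i ≡ 0ℤ) → ∑ n f ≡ 0ℤ
  ∑-zero zero    f≡0 = refl
  ∑-zero (suc n) f≡0 = cong₂ _+_ (f≡0 0 (s≤s z≤n)) (∑-zero n (λ i i<n → f≡0 (suc i) (s≤s i<n)))

  ∑-distrib-+ : ∀ n (f g : ℕ → ℤ) → ∑ n (λ i → f i + g i) ≡ ∑ n f + ∑ n g
  ∑-distrib-+ zero    f g = refl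
  ∑-distrib-+ (suc n) f g = begin
    (f 0 + g 0) + ∑ n (λ i → f (suc i) + g (suc i)) ≡⟨ cong ((f 0 + g 0) +_) (∑-distrib-+ n (f ∘ suc) (g ∘ suc)) ⟩
    (f 0 + g 0) + (∑ n (f ∘ suc) + ∑ n (g ∘ suc))  ≡⟨ interchange (f 0) (g 0) _ _ ⟩
    (f 0 + ∑ n (f ∘ suc)) + (g 0 + ∑ n (g ∘ suc))  ∎
    where
    interchange : ∀ a b c d → (a + b) + (c + d) ≡ (a + c) + (b + d)
    interchange = solve-∀

  ∑-*ˡ : ∀ n c (f : ℕ → ℤ) → ∑ n (λ i → c * f i) ≡ c * ∑ n f
  ∑-*ˡ zero    c f = sym (*-zeroʳ c)
  ∑-*ˡ (suc n) c f = trans (cong (c * f 0 +_) (∑-*ˡ n c (f ∘ suc))) (sym (*-distribˡ-+ c (f 0) _))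

  ∑-last : ∀ n (f : ℕ → ℤ) → ∑ (suc n) f ≡ ∑ n f + f n
  ∑-last zero    f = +-comm (f 0) 0ℤ
  ∑-last (suc n) f = trans (cong (f 0 +_) (∑-last n (f ∘ suc))) (sym (+-assoc (f 0) _ _))

  ∑-reverse : ∀ n (f : ℕ → ℤ) → ∑ n f ≡ ∑ n (λ i → f (n ∸ suc i))
  ∑-reverse zero    f = refl
  ∑-reverse (suc n) f = begin
    f 0 + ∑ n (f ∘ suc)                      ≡⟨ cong (f 0 +_) (∑-reverse n (f ∘ suc)) ⟩
    f 0 + ∑ n (λ i → f (suc (n ∸ suc i)))    ≡⟨ cong (f 0 +_) (∑-cong n (λ i i<n → cong f (sym (ℕ.+-∸-assoc 1 i<n)))) ⟩
    f 0 + ∑ n (λ i → f (n ∸ i))              ≡⟨ +-comm (f 0) _ ⟩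
    ∑ n (λ i → f (n ∸ i)) + f 0              ≡⟨ cong (λ k → ∑ n (λ i → f (n ∸ i)) + f k) (ℕ.n∸n≡0 n) ⟨
    ∑ n (λ i → f (n ∸ i)) + f (n ∸ n)        ≡⟨ ∑-last n (λ i → f (n ∸ i)) ⟨
    ∑ (suc n) (λ i → f (n ∸ i))              ∎

  infixl 6 _⊕_
  infixl 7 _⊗_
  infix  8 ⊖_

  _⊕_ : Series → Series → Series
  (f ⊕ g) n = f n + g n

  ⊖_ : Series → Series
  (⊖ f) n = - f n

  _⊗_ : Series → Series → Series
  (f ⊗ g) n = ∑ (suc n) (λ i → f i * g (n ∸ i))

  cst : ℤ → Series
  cst c zero    = c
  cst c (suc _) = 0ℤ

  𝟘 𝟙 : Series
  𝟘 _ = 0ℤ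
  𝟙   = cst 1ℤ

  tail : Series → Series
  tail f = f ∘ suc

  ⊛≗⊗ : ∀ f g → f ⊛ g ≗ f ⊗ g
  ⊛≗⊗ f g n = foldr-applyUpTo (λ i → f i * g (n ∸ i)) (λ i → i) (suc n)
    where
    foldr-applyUpTo : ∀ (h : ℕ → ℤ) k m → foldr _+_ 0ℤ (map h (applyUpTo k m)) ≡ ∑ m (h ∘ k)
    foldr-applyUpTo h k zero    = refl
    foldr-applyUpTo h k (suc m) = cong (h (k 0) +_) (foldr-applyUpTo h (k ∘ suc) m)

  ⊗-coeff-congˡ : ∀ {f f′} g n → (∀ i → i ≤ n → f i ≡ f′ i) → (f ⊗ g) n ≡ (f′ ⊗ g) n
  ⊗-coeff-congˡ g n f≡f′ = ∑-cong (suc n) (λ { i (s≤s i≤n) → cong (_* g (n ∸ i)) (f≡f′ i i≤n) })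

  ⊗-coeff-congʳ : ∀ f {g g′} n → (∀ i → i ≤ n → g i ≡ g′ i) → (f ⊗ g) n ≡ (f ⊗ g′) n
  ⊗-coeff-congʳ f n g≡g′ = ∑-cong (suc n) (λ i _ → cong (f i *_) (g≡g′ (n ∸ i) (ℕ.m∸n≤m n i)))

  ⊗-comm : ∀ f g → f ⊗ g ≗ g ⊗ f
  ⊗-comm f g n = begin
    ∑ (suc n) (λ i → f i * g (n ∸ i))              ≡⟨ ∑-reverse (suc n) (λ i → f i * g (n ∸ i)) ⟩
    ∑ (suc n) (λ i → f (n ∸ i) * g (n ∸ (n ∸ i)))  ≡⟨ ∑-cong (suc n) (λ { i (s≤s i≤n) → swap i i≤n }) ⟩
    ∑ (suc n) (λ i → g i * f (n ∸ i))              ∎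
    where
    swap : ∀ i → i ≤ n → f (n ∸ i) * g (n ∸ (n ∸ i)) ≡ g i * f (n ∸ i)
    swap i i≤n = trans (*-comm (f (n ∸ i)) _) (cong (λ k → g k * f (n ∸ i)) (ℕ.m∸[m∸n]≡n i≤n))

  ⊗-distribʳ-⊕ : ∀ h f g → (f ⊕ g) ⊗ h ≗ f ⊗ h ⊕ g ⊗ h
  ⊗-distribʳ-⊕ h f g n =
    trans (∑-cong (suc n) (λ i _ → *-distribʳ-+ (h (n ∸ i)) (f i) (g i)))
          (∑-distrib-+ (suc n) (λ i → f i * h (n ∸ i)) (λ i → g i * h (n ∸ i)))

  cst-⊗ : ∀ c f → cst c ⊗ f ≗ λ n → c * f n
  cst-⊗ c f zero    = +-identityʳ _
  cst-⊗ c f (suc n) =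
    trans (cong (c * f (suc n) +_) (∑-zero (suc n) (λ i _ → *-zeroˡ (f (n ∸ i))))) (+-identityʳ _)

  ⊗-assoc : ∀ f g h → (f ⊗ g) ⊗ h ≗ f ⊗ (g ⊗ h)
  ⊗-assoc f g h zero    = constant-term (f 0) (g 0) (h 0)
    where
    constant-term : ∀ a b c → (a * b + 0ℤ) * c + 0ℤ ≡ a * (b * c + 0ℤ) + 0ℤ
    constant-term = solve-∀
  -- (f ⊗ g) (suc n) unfolds to f 0 * g (suc n) + (tail f ⊗ g) n.
  ⊗-assoc f g h (suc n) = begin
    (f ⊗ g) 0 * h (suc n) + ((λ j → f 0 * g (suc j) + (tail f ⊗ g) j) ⊗ h) n
      ≡⟨ cong ((f ⊗ g) 0 * h (suc n) +_) (⊗-distribʳ-⊕ h (λ j → f 0 * g (suc j)) (tail f ⊗ g) n) ⟩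
    (f ⊗ g) 0 * h (suc n) + (((λ j → f 0 * g (suc j)) ⊗ h) n + ((tail f ⊗ g) ⊗ h) n)
      ≡⟨ cong₂ (λ u v → (f ⊗ g) 0 * h (suc n) + (u + v)) (∑-*-assoc) (⊗-assoc (tail f) g h n) ⟩
    (f ⊗ g) 0 * h (suc n) + (f 0 * (tail g ⊗ h) n + (tail f ⊗ (g ⊗ h)) n)
      ≡⟨ regroup (f 0) (g 0) (h (suc n)) _ _ ⟩
    f 0 * (g 0 * h (suc n) + (tail g ⊗ h) n) + (tail f ⊗ (g ⊗ h)) n  ∎
    where
    ∑-*-assoc : ((λ j → f 0 * g (suc j)) ⊗ h) n ≡ f 0 * (tail g ⊗ h) n
    ∑-*-assoc = trans (∑-cong (suc n) {g = λ i → f 0 * (g (suc i) * h (n ∸ i))} (λ i _ → *-assoc (f 0) (g (suc i)) _))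
                      (∑-*ˡ (suc n) (f 0) (λ i → g (suc i) * h (n ∸ i)))
    regroup : ∀ a b c d e → (a * b + 0ℤ) * c + (a * d + e) ≡ a * (b * c + d) + e
    regroup = solve-∀

  𝟙-⊗ : ∀ f → 𝟙 ⊗ f ≗ f
  𝟙-⊗ f n = trans (cst-⊗ 1ℤ f n) (*-identityˡ (f n))

  -- A record rather than f ≗ g, so that f and g can be inferred from a proof of f ≈ g.
  infix 4 _≈_
  record _≈_ (f g : Series) : Set where
    constructor coeffs
    field coeff : f ≗ g
  open _≈_ public

  isCommutativeRing : IsCommutativeRing _≈_ _⊕_ _⊗_ ⊖_ 𝟘 𝟙
  isCommutativeRing = record
    { isRing = record
      { +-isAbelianGroup = record
        { isGroup = record
          { isMonoid = record
            { isSemigroup = record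
              { isMagma = record
                { isEquivalence = record
                  { refl  = coeffs (λ _ → refl)
                  ; sym   = λ f≈g → coeffs (sym ∘ coeff f≈g)
                  ; trans = λ f≈g g≈h → coeffs (λ n → trans (coeff f≈g n) (coeff g≈h n))
                  }
                ; ∙-cong = λ f≈f′ g≈g′ → coeffs (λ n → cong₂ _+_ (coeff f≈f′ n) (coeff g≈g′ n))
                }
              ; assoc = λ f g h → coeffs (λ n → +-assoc (f n) (g n) (h n))
              }
            ; identity = (λ f → coeffs (+-identityˡ ∘ f)) , (λ f → coeffs (+-identityʳ ∘ f))
            }
          ; inverse = (λ f → coeffs (+-inverseˡ ∘ f)) , (λ f → coeffs (+-inverseʳ ∘ f))
          ; ⁻¹-cong = λ f≈g → coeffs (cong -_ ∘ coeff f≈g)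
          }
        ; comm = λ f g → coeffs (λ n → +-comm (f n) (g n))
        }
      ; *-cong = λ {f} {f′} {g} {g′} f≈f′ g≈g′ → coeffs (λ n →
          trans (⊗-coeff-congˡ g n (λ i _ → coeff f≈f′ i)) (⊗-coeff-congʳ f′ n (λ i _ → coeff g≈g′ i)))
      ; *-assoc    = λ f g h → coeffs (⊗-assoc f g h)
      ; *-identity = (λ f → coeffs (𝟙-⊗ f)) , (λ f → coeffs (λ n → trans (⊗-comm f 𝟙 n) (𝟙-⊗ f n)))
      ; distrib    = (λ h f g → coeffs (λ n → begin
                        (h ⊗ (f ⊕ g)) n        ≡⟨ ⊗-comm h (f ⊕ g) n ⟩
                        ((f ⊕ g) ⊗ h) n        ≡⟨ ⊗-distribʳ-⊕ h f g n ⟩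
                        (f ⊗ h ⊕ g ⊗ h) n      ≡⟨ cong₂ _+_ (⊗-comm f h n) (⊗-comm g h n) ⟩
                        (h ⊗ f ⊕ h ⊗ g) n      ∎))
                   , (λ h f g → coeffs (⊗-distribʳ-⊕ h f g))
      }
    ; *-comm = λ f g → coeffs (⊗-comm f g)
    }

  ⊕-congˡ : ∀ {f g} h → f ≈ g → f ⊕ h ≈ g ⊕ h
  ⊕-congˡ h f≈g = coeffs (λ n → cong (_+ h n) (coeff f≈g n))

  ⊕-congʳ : ∀ f {g h} → g ≈ h → f ⊕ g ≈ f ⊕ h
  ⊕-congʳ f g≈h = coeffs (λ n → cong (f n +_) (coeff g≈h n))

  ⊗-congˡ : ∀ {f g} h → f ≈ g → f ⊗ h ≈ g ⊗ h
  ⊗-congˡ h f≈g = coeffs (λ n → ⊗-coeff-congˡ h n (λ i _ → coeff f≈g i))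

  ⊗-congʳ : ∀ f {g h} → g ≈ h → f ⊗ g ≈ f ⊗ h
  ⊗-congʳ f g≈h = coeffs (λ n → ⊗-coeff-congʳ f n (λ i _ → coeff g≈h i))

  seriesRing : CommutativeRing 0ℓ 0ℓ
  seriesRing = record { isCommutativeRing = isCommutativeRing }

  open CommutativeRing seriesRing public using () renaming (refl to ≈-refl; sym to ≈-sym; trans to ≈-trans)

  cst-homomorphism : ℤ.+-*-rawRing -Raw-AlmostCommutative⟶ fromCommutativeRing seriesRing
  cst-homomorphism = record
    { ⟦_⟧    = cst
    ; +-homo = λ a b → coeffs (λ { zero → refl ; (suc n) → refl })
    ; *-homo = λ a b → coeffs (λ n → sym (trans (cst-⊗ a (cst b) n) (cst-* a b n)))
    ; -‿homo = λ a → coeffs (λ { zero → refl ; (suc n) → refl })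
    ; 0-homo = coeffs (λ { zero → refl ; (suc n) → refl })
    ; 1-homo = coeffs (λ { zero → refl ; (suc n) → refl })
    }
    where
    cst-* : ∀ a b n → a * cst b n ≡ cst (a * b) n
    cst-* a b zero    = refl
    cst-* a b (suc n) = *-zeroʳ a

  cst-≟ : ∀ a b → Maybe (cst a ≈ cst b)
  cst-≟ a b with a ℤ.≟ b
  ... | yes refl = just ≈-refl
  ... | no  _    = nothing

  open Algebra.Solver.Ring ℤ.+-*-rawRing (fromCommutativeRing seriesRing) cst-homomorphism cst-≟ public
    using (solve; _:=_; _:+_; _:*_; :-_; _:-_; con)

  shift : Series → Series
  shift s zero    = 0ℤ
  shift s (suc n) = s n

  X : Series
  X = shift 𝟙

  X-⊗ : ∀ s → X ⊗ s ≈ shift s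
  X-⊗ s = coeffs λ
    { zero    → refl
    ; (suc n) → trans (cong (_+ (𝟙 ⊗ s) n) (*-zeroˡ (s (suc n)))) (trans (+-identityˡ _) (𝟙-⊗ s n))
    }

  shift-cong : ∀ {f g} → f ≈ g → shift f ≈ shift g
  shift-cong f≈g = coeffs λ { zero → refl ; (suc n) → coeff f≈g n }

  x² x³ : Series
  x² = X ⊗ X
  x³ = X ⊗ x²

  x²-⊗ : ∀ s → x² ⊗ s ≈ shift (shift s)
  x²-⊗ s = ≈-trans (coeffs (⊗-assoc X X s)) (≈-trans (X-⊗ (X ⊗ s)) (shift-cong (X-⊗ s)))

  x³-⊗ : ∀ s → x³ ⊗ s ≈ shift (shift (shift s))
  x³-⊗ s = ≈-trans (coeffs (⊗-assoc X x² s)) (≈-trans (X-⊗ (x² ⊗ s)) (shift-cong (x²-⊗ s)))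

  x³≈ : x³ ≈ shift (shift X)
  x³≈ = ≈-trans (X-⊗ x²) (shift-cong (X-⊗ X))

  ⊗-cancelʳ : ∀ f g → f ⊗ g ≈ 𝟘 → g 0 ≢ 0ℤ → f ≈ 𝟘
  ⊗-cancelʳ f g fg≈0 g₀≢0 = coeffs (λ n → vanish n n ℕ.≤-refl)
    where
    g₀-cancel : ∀ {a} → g 0 * a ≡ 0ℤ → a ≡ 0ℤ
    g₀-cancel g₀a≡0 with i*j≡0⇒i≡0∨j≡0 (g 0) g₀a≡0
    ... | inj₁ g₀≡0 = ⊥-elim (g₀≢0 g₀≡0)
    ... | inj₂ a≡0  = a≡0
    gf≡0 : ∀ n → (g ⊗ f) n ≡ 0ℤ
    gf≡0 n = trans (⊗-comm g f n) (coeff fg≈0 n)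
    vanish : ∀ n i → i ≤ n → f i ≡ 0ℤ
    vanish zero    zero z≤n = g₀-cancel (trans (sym (+-identityʳ _)) (gf≡0 0))
    vanish (suc n) i i≤1+n with ℕ.m≤n⇒m<n∨m≡n i≤1+n
    ... | inj₁ (s≤s i≤n) = vanish n i i≤n
    ... | inj₂ refl      = g₀-cancel (begin
      g 0 * f (suc n)                                 ≡⟨ +-identityʳ _ ⟨
      g 0 * f (suc n) + 0ℤ                            ≡⟨ cong (g 0 * f (suc n) +_) lower-terms ⟨
      g 0 * f (suc n) + (tail g ⊗ f) n                ≡⟨ gf≡0 (suc n) ⟩
      0ℤ                                              ∎)
      where
      lower-terms : (tail g ⊗ f) n ≡ 0ℤ
      lower-terms = trans (⊗-coeff-congʳ (tail g) n (λ j j≤n → vanish n j j≤n))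
                          (∑-zero (suc n) (λ j _ → *-zeroʳ (g (suc j))))

  infix 4 _≡[≤_]_
  _≡[≤_]_ : Series → ℕ → Series → Set
  f ≡[≤ n ] g = ∀ i → i ≤ n → f i ≡ g i

  ⊕-cong-≤ : ∀ {n f f′ g g′} → f ≡[≤ n ] f′ → g ≡[≤ n ] g′ → f ⊕ g ≡[≤ n ] f′ ⊕ g′
  ⊕-cong-≤ f≡f′ g≡g′ i i≤n = cong₂ _+_ (f≡f′ i i≤n) (g≡g′ i i≤n)

  ⊖-cong-≤ : ∀ {n f f′} → f ≡[≤ n ] f′ → ⊖ f ≡[≤ n ] ⊖ f′
  ⊖-cong-≤ f≡f′ i i≤n = cong -_ (f≡f′ i i≤n)

  ⊗-cong-≤ : ∀ {n f f′ g g′} → f ≡[≤ n ] f′ → g ≡[≤ n ] g′ → f ⊗ g ≡[≤ n ] f′ ⊗ g′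
  ⊗-cong-≤ {f′ = f′} {g = g} f≡f′ g≡g′ i i≤n =
    trans (⊗-coeff-congˡ g i (λ j j≤i → f≡f′ j (ℕ.≤-trans j≤i i≤n)))
          (⊗-coeff-congʳ f′ i (λ j j≤i → g≡g′ j (ℕ.≤-trans j≤i i≤n)))

  difference-≈𝟘 : ∀ {f g} → f ≈ g → f ⊕ ⊖ g ≈ 𝟘
  difference-≈𝟘 {g = g} f≈g = coeffs (λ n → trans (cong (_+ - g n) (coeff f≈g n)) (+-inverseʳ (g n)))

  ≈-from-difference : ∀ {f g} → f ⊕ ⊖ g ≈ 𝟘 → f ≈ g
  ≈-from-difference {f} {g} f-g≈0 = coeffs (λ n → i-j≡0⇒i≡j (f n) (g n) (coeff f-g≈0 n))

  ⊕-≈𝟘 : ∀ {f g} → f ≈ 𝟘 → g ≈ 𝟘 → f ⊕ g ≈ 𝟘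
  ⊕-≈𝟘 f≈0 g≈0 = coeffs (λ n → cong₂ _+_ (coeff f≈0 n) (coeff g≈0 n))

  ⊗-≈𝟘 : ∀ f {g} → g ≈ 𝟘 → f ⊗ g ≈ 𝟘
  ⊗-≈𝟘 f g≈0 = coeffs (λ n →
    trans (⊗-coeff-congʳ f n (λ i _ → coeff g≈0 i)) (∑-zero (suc n) (λ i _ → *-zeroʳ (f i))))

module Paths where

  open import Defs
  open import Data.Empty using (⊥-elim)
  open import Data.List using (List; []; _∷_; _++_; [_]; length; initLast; _∷ʳ′_)
  import Data.List.Properties as List
  open import Data.Nat using (ℕ; zero; suc; _∸_; _≤_; _⊔_; _+_; z≤n; s≤s)
  import Data.Nat.Properties as ℕ
  open import Data.Product using (∃-syntax; _×_; _,_)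
  open import Data.Sum using (_⊎_; inj₁; inj₂)
  open import Relation.Binary.PropositionalEquality hiding ([_])

  private variable
    h h′ h″ : ℕ
    p q : List Step

  walk-++ : Walk h p h′ → Walk h′ q h″ → Walk h (p ++ q) h″
  walk-++ nil         w = w
  walk-++ (up wp)     w = up (walk-++ wp w)
  walk-++ (dn m le wp) w = dn m le (walk-++ wp w)

  walk-split : ∀ p → Walk h (p ++ q) h″ → ∃[ h′ ] Walk h p h′ × Walk h′ q h″
  walk-split []           w = _ , nil , w
  walk-split (U ∷ p)      (up w) with walk-split p w
  ... | h′ , wp , wq = h′ , up wp , wq
  walk-split (down m ∷ p) (dn .m le w) with walk-split p w
  ... | h′ , wp , wq = h′ , dn m le wp , wq

  walk-end-unique : Walk h p h′ → Walk h p h″ → h′ ≡ h″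
  walk-end-unique nil         nil          = refl
  walk-end-unique (up w)      (up w′)      = walk-end-unique w w′
  walk-end-unique (dn m _ w)  (dn .m _ w′) = walk-end-unique w w′

  walk-raise : Walk h p h′ → Walk (suc h) p (suc h′)
  walk-raise nil = nil
  walk-raise (up w) = up (walk-raise w)
  walk-raise {p = down m ∷ p} {h′ = h′} (dn m (s≤s m≤h) w) =
    dn m (ℕ.m≤n⇒m≤1+n (s≤s m≤h)) (subst (λ h → Walk h p (suc h′)) (sym (ℕ.+-∸-assoc 1 m≤h)) (walk-raise w))

  walk-from-0-starts-U : ∀ {s} → Walk 0 (s ∷ p) h → s ≡ U
  walk-from-0-starts-U (up w) = refl

  walk-to-0-ends-down : ∀ p {s} → Walk h (p ++ [ s ]) 0 → ∃[ m ] s ≡ down m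
  walk-to-0-ends-down p w with walk-split p w
  ... | _ , _ , dn m _ _ = m , refl

  maxFrom-≥ : ∀ h p → h ≤ maxFrom h p
  maxFrom-≥ h []           = ℕ.≤-refl
  maxFrom-≥ h (U ∷ p)      = ℕ.m≤m⊔n h _
  maxFrom-≥ h (down m ∷ p) = ℕ.m≤m⊔n h _

  walk-end≤maxFrom : Walk h p h′ → h′ ≤ maxFrom h p
  walk-end≤maxFrom nil = ℕ.≤-refl
  walk-end≤maxFrom {h} (up w)     = ℕ.≤-trans (walk-end≤maxFrom w) (ℕ.m≤n⊔m h _)
  walk-end≤maxFrom {h} (dn m _ w) = ℕ.≤-trans (walk-end≤maxFrom w) (ℕ.m≤n⊔m h _)

  maxFrom-++ : Walk h p h′ → ∀ q → maxFrom h (p ++ q) ≡ maxFrom h p ⊔ maxFrom h′ q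
  maxFrom-++ {h} nil        q = sym (ℕ.m≤n⇒m⊔n≡n (maxFrom-≥ h q))
  maxFrom-++ {h} (up w)     q = trans (cong (h ⊔_) (maxFrom-++ w q)) (sym (ℕ.⊔-assoc h _ _))
  maxFrom-++ {h} (dn m _ w) q = trans (cong (h ⊔_) (maxFrom-++ w q)) (sym (ℕ.⊔-assoc h _ _))

  maxFrom-∷ʳ-down : Walk h p h′ → ∀ m → maxFrom h (p ++ [ down m ]) ≡ maxFrom h p
  maxFrom-∷ʳ-down w m = trans (maxFrom-++ w _) (ℕ.m≥n⇒m⊔n≡m (ℕ.⊔-lub end≤max (ℕ.≤-trans (ℕ.m∸n≤m _ (suc m)) end≤max)))
    where end≤max = walk-end≤maxFrom w

  maxFrom-raise : Walk h p h′ → maxFrom (suc h) p ≡ suc (maxFrom h p)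
  maxFrom-raise nil = refl
  maxFrom-raise {h} (up w) = cong (suc h ⊔_) (maxFrom-raise w)
  maxFrom-raise {h} {down m ∷ p} (dn m (s≤s m≤h) w) =
    cong (suc h ⊔_) (trans (cong (λ h → maxFrom h p) (ℕ.+-∸-assoc 1 m≤h)) (maxFrom-raise w))

  maxFrom≤+length : ∀ h p → maxFrom h p ≤ h + length p
  maxFrom≤+length h [] = ℕ.m≤m+n h 0
  maxFrom≤+length h (U ∷ p) = ℕ.⊔-lub (ℕ.m≤m+n h _)
    (subst (maxFrom (suc h) p ≤_) (sym (ℕ.+-suc h (length p))) (maxFrom≤+length (suc h) p))
  maxFrom≤+length h (down m ∷ p) = ℕ.⊔-lub (ℕ.m≤m+n h _) (begin
    maxFrom (h ∸ suc m) p   ≤⟨ maxFrom≤+length (h ∸ suc m) p ⟩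
    h ∸ suc m + length p    ≤⟨ ℕ.+-monoˡ-≤ (length p) (ℕ.m∸n≤m h (suc m)) ⟩
    h + length p            ≤⟨ ℕ.+-monoʳ-≤ h (ℕ.n≤1+n (length p)) ⟩
    h + suc (length p)      ∎)
    where open ℕ.≤-Reasoning

  ht≤length : ∀ p → ht p ≤ length p
  ht≤length = maxFrom≤+length 0

  raiseLast : List Step → List Step
  raiseLast []                = []
  raiseLast (down m ∷ [])     = down (suc m) ∷ []
  raiseLast (s ∷ p)           = s ∷ raiseLast p

  -- Inverse of the lowering α ↦ α♭: prefix U and raise the final step D_k to D_{k+1}.
  lift : List Step → List Step
  lift δ = U ∷ raiseLast δ

  raiseLast-∷ʳ-down : ∀ r m → raiseLast (r ++ [ down m ]) ≡ r ++ [ down (suc m) ]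
  raiseLast-∷ʳ-down []               m = refl
  raiseLast-∷ʳ-down (U ∷ [])         m = refl
  raiseLast-∷ʳ-down (down k ∷ [])    m = refl
  raiseLast-∷ʳ-down (U ∷ s ∷ r)      m = cong (U ∷_) (raiseLast-∷ʳ-down (s ∷ r) m)
  raiseLast-∷ʳ-down (down k ∷ s ∷ r) m = cong (down k ∷_) (raiseLast-∷ʳ-down (s ∷ r) m)

  lowerLast-∷ʳ-down : ∀ r m → lowerLast (r ++ [ down (suc m) ]) ≡ r ++ [ down m ]
  lowerLast-∷ʳ-down []                     m = refl
  lowerLast-∷ʳ-down (U ∷ [])               m = refl
  lowerLast-∷ʳ-down (down zero ∷ [])       m = refl
  lowerLast-∷ʳ-down (down (suc k) ∷ [])    m = refl
  lowerLast-∷ʳ-down (U ∷ s ∷ r)            m = cong (U ∷_) (lowerLast-∷ʳ-down (s ∷ r) m)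
  lowerLast-∷ʳ-down (down zero ∷ s ∷ r)    m = cong (down zero ∷_) (lowerLast-∷ʳ-down (s ∷ r) m)
  lowerLast-∷ʳ-down (down (suc k) ∷ s ∷ r) m = cong (down (suc k) ∷_) (lowerLast-∷ʳ-down (s ∷ r) m)

  lower-lift : ∀ r m → lower (lift (r ++ [ down m ])) ≡ r ++ [ down m ]
  lower-lift r m = trans (cong lowerLast (raiseLast-∷ʳ-down r m)) (lowerLast-∷ʳ-down r m)

  length-raiseLast : ∀ δ → length (raiseLast δ) ≡ length δ
  length-raiseLast []                = refl
  length-raiseLast (U ∷ [])          = refl
  length-raiseLast (down m ∷ [])     = refl
  length-raiseLast (U ∷ s ∷ p)       = cong suc (length-raiseLast (s ∷ p))
  length-raiseLast (down m ∷ s ∷ p)  = cong suc (length-raiseLast (s ∷ p))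

  length-lift : ∀ δ → length (lift δ) ≡ suc (length δ)
  length-lift δ = cong suc (length-raiseLast δ)

  noDD-++-U : ∀ {p q} → NoDD p → NoDD (U ∷ q) → NoDD (p ++ U ∷ q)
  noDD-++-U nd-nil            d = d
  noDD-++-U (nd-one U)        d = nd-U d
  noDD-++-U (nd-one (down m)) d = nd-downU d
  noDD-++-U (nd-U r)          d = nd-U (noDD-++-U r d)
  noDD-++-U (nd-downU r)      d = nd-downU (noDD-++-U r d)

  noDD-change-last-down : ∀ r m k → NoDD (r ++ [ down m ]) → NoDD (r ++ [ down k ])
  noDD-change-last-down []                m k _            = nd-one _
  noDD-change-last-down (U ∷ [])          m k _            = nd-U (nd-one _)
  noDD-change-last-down (U ∷ s ∷ r)       m k (nd-U d)     = nd-U (noDD-change-last-down (s ∷ r) m k d)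
  noDD-change-last-down (down j ∷ U ∷ r)  m k (nd-downU d) = nd-downU (noDD-change-last-down (U ∷ r) m k d)

  noDD-lift : ∀ r m → NoDD (r ++ [ down m ]) → NoDD (lift (r ++ [ down m ]))
  noDD-lift []      m d = nd-U (nd-one _)
  noDD-lift (s ∷ r) m d rewrite raiseLast-∷ʳ-down (s ∷ r) m =
    nd-U (noDD-change-last-down (s ∷ r) m (suc m) d)

  prefix-of-∷ʳ : ∀ p q r {s : Step} → r ++ [ s ] ≡ p ++ q → q ≢ [] → ∃[ t ] r ≡ p ++ t
  prefix-of-∷ʳ []      q r       eq q≢[] = r , refl
  prefix-of-∷ʳ (x ∷ p) q []      eq q≢[] = ⊥-elim (q≢[] (List.++-conicalʳ p q (sym (List.∷-injectiveʳ eq))))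
  prefix-of-∷ʳ (x ∷ p) q (y ∷ r) eq q≢[] with List.∷-injective eq
  ... | refl , eq′ with prefix-of-∷ʳ p q r eq′ q≢[]
  ... | t , refl = t , refl

  ++-prefixes : ∀ (α β α′ β′ : List Step) → α ++ β ≡ α′ ++ β′ →
                (∃[ s ] α′ ≡ α ++ s) ⊎ (∃[ s ] α ≡ α′ ++ s)
  ++-prefixes []      β α′       β′ eq = inj₁ (α′ , refl)
  ++-prefixes (x ∷ α) β []       β′ eq = inj₂ (x ∷ α , refl)
  ++-prefixes (x ∷ α) β (y ∷ α′) β′ eq with List.∷-injective eq
  ... | refl , eq′ with ++-prefixes α β α′ β′ eq′
  ... | inj₁ (s , refl) = inj₁ (s , refl)
  ... | inj₂ (s , refl) = inj₂ (s , refl)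

  lift-onlyEndTouches : ∀ r m → Walk 0 r h → OnlyEndTouches (U ∷ r ++ [ down (suc m) ])
  lift-onlyEndTouches r m wr []      q eq p≢[] q≢[] w = p≢[] refl
  lift-onlyEndTouches r m wr (x ∷ p) q eq p≢[] q≢[] (up w)
    with prefix-of-∷ʳ p q r (List.∷-injectiveʳ eq) q≢[]
  ... | t , refl with walk-split p wr
  ... | _ , wp , _ with walk-end-unique (walk-raise wp) w
  ... | ()

  UD-onlyEndTouches : OnlyEndTouches UD
  UD-onlyEndTouches []              q eq p≢[] q≢[] w = p≢[] refl
  UD-onlyEndTouches (x ∷ [])        q eq p≢[] q≢[] (up ())
  UD-onlyEndTouches (x ∷ y ∷ p)     q eq p≢[] q≢[] w =
    q≢[] (List.++-conicalʳ p q (sym (List.∷-injectiveʳ (List.∷-injectiveʳ eq))))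

  Arch : List Step → Set
  Arch α = FirstReturn α × (α ≡ UD ⊎ (Prime α × H (lower α)))

  private variable
    α β δ : List Step

  arch-nonempty : Arch α → α ≢ []
  arch-nonempty ((α≢[] , _) , _) = α≢[]

  arch-walk : Arch α → Walk 0 α 0
  arch-walk ((_ , w , _) , _) = w

  arch-onlyEndTouches : Arch α → OnlyEndTouches α
  arch-onlyEndTouches ((_ , _ , touches) , _) = touches

  arch-noDD : Arch α → NoDD α
  arch-noDD (_ , inj₁ refl)                    = nd-U (nd-one _)
  arch-noDD (_ , inj₂ (((_ , _ , d) , _) , _)) = d

  H-walk : H β → Walk 0 β 0
  H-walk empty                       = nil
  H-walk (node _ _ (_ , w , _) _ _ _ _) = w

  H-ht-positive : H δ → δ ≢ [] → 1 ≤ ht δ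
  H-ht-positive {[]}    _  δ≢[] = ⊥-elim (δ≢[] refl)
  H-ht-positive {_ ∷ δ} hδ _ with H-walk hδ
  ... | up _ = maxFrom-≥ 1 δ

  H-noDD : H β → NoDD β
  H-noDD empty                          = nd-nil
  H-noDD (node _ _ (_ , _ , d) _ _ _ _) = d

  H-++ : Arch α → H β → ht β ≤ ht α → H (α ++ β)
  H-++ {α} {β} a@(fr , c) hβ hβ≤hα =
    node α β (α++β≢[] , walk-++ (arch-walk a) (H-walk hβ) , noDD β hβ) fr c hβ hβ≤hα
    where
    α++β≢[] : α ++ β ≢ []
    α++β≢[] eq = arch-nonempty a (List.++-conicalˡ α β eq)
    noDD : ∀ β → H β → NoDD (α ++ β)
    noDD []      _  = subst NoDD (sym (List.++-identityʳ α)) (arch-noDD a)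
    noDD (s ∷ β) hβ with walk-from-0-starts-U (H-walk hβ)
    ... | refl = noDD-++-U (arch-noDD a) (H-noDD hβ)

  H-decompose : H δ → δ ≢ [] → ∃[ α ] ∃[ β ] δ ≡ α ++ β × Arch α × H β × ht β ≤ ht α
  H-decompose empty                       δ≢[] = ⊥-elim (δ≢[] refl)
  H-decompose (node α β _ fr c hβ hβ≤hα) _    = α , β , refl , (fr , c) , hβ , hβ≤hα

  arch-prefix-unique : ∀ {α′ β′} → Arch α → Arch α′ → α ++ β ≡ α′ ++ β′ → α ≡ α′
  arch-prefix-unique {α} {β} {α′} {β′} a a′ eq with ++-prefixes α β α′ β′ eq
  ... | inj₁ ([] , refl)    = sym (List.++-identityʳ α)
  ... | inj₁ (s ∷ t , refl) = ⊥-elim (arch-onlyEndTouches a′ α (s ∷ t) refl (arch-nonempty a) (λ ()) (arch-walk a))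
  ... | inj₂ ([] , refl)    = List.++-identityʳ α′
  ... | inj₂ (s ∷ t , refl) = ⊥-elim (arch-onlyEndTouches a α′ (s ∷ t) refl (arch-nonempty a′) (λ ()) (arch-walk a′))

  ht-arch-++ : Arch α → ht β ≤ ht α → ht (α ++ β) ≡ ht α
  ht-arch-++ {α} {β} a hβ≤hα = trans (maxFrom-++ (arch-walk a) β) (ℕ.m≥n⇒m⊔n≡m hβ≤hα)

  UD-arch : Arch UD
  UD-arch = ((λ ()) , up (dn 0 (s≤s z≤n) nil) , UD-onlyEndTouches) , inj₁ refl

  H-ends-down : H δ → δ ≢ [] → ∃[ r ] ∃[ m ] δ ≡ r ++ [ down m ]
  H-ends-down {δ} hδ δ≢[] with initLast δ
  ... | []       = ⊥-elim (δ≢[] refl)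
  ... | r ∷ʳ′ s with walk-to-0-ends-down r (H-walk hδ)
  ... | m , refl = r , m , refl

  lift-arch-∷ʳ : ∀ r m → H (r ++ [ down m ]) →
                 Arch (U ∷ r ++ [ down (suc m) ]) × ht (U ∷ r ++ [ down (suc m) ]) ≡ suc (ht (r ++ [ down m ]))
  lift-arch-∷ʳ r m hδ with walk-split r (H-walk hδ)
  ... | e , wr , dn .m m<e w₀ = (firstReturn , inj₂ (prime , H-lower)) , ht-lift
    where
    w : Walk 0 (U ∷ r ++ [ down (suc m) ]) 0
    w = up (walk-++ (walk-raise wr) (dn (suc m) (s≤s m<e) w₀))
    firstReturn : FirstReturn (U ∷ r ++ [ down (suc m) ])
    firstReturn = (λ ()) , w , lift-onlyEndTouches r m wr
    prime : Prime (U ∷ r ++ [ down (suc m) ])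
    prime = ((λ ()) , w , subst NoDD (cong (U ∷_) (raiseLast-∷ʳ-down r m)) (noDD-lift r m (H-noDD hδ)))
          , lift-onlyEndTouches r m wr , m , U ∷ r , refl
    H-lower : H (lower (U ∷ r ++ [ down (suc m) ]))
    H-lower = subst H (sym (lowerLast-∷ʳ-down r m)) hδ
    ht-lift : ht (U ∷ r ++ [ down (suc m) ]) ≡ suc (ht (r ++ [ down m ]))
    ht-lift = begin
      maxFrom 1 (r ++ [ down (suc m) ])  ≡⟨ maxFrom-∷ʳ-down (walk-raise wr) (suc m) ⟩
      maxFrom 1 r                        ≡⟨ maxFrom-raise wr ⟩
      suc (ht r)                         ≡⟨ cong suc (maxFrom-∷ʳ-down wr m) ⟨
      suc (ht (r ++ [ down m ]))         ∎
      where open ≡-Reasoning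

  lift-arch : H δ → δ ≢ [] → Arch (lift δ) × ht (lift δ) ≡ suc (ht δ)
  lift-arch hδ δ≢[] with H-ends-down hδ δ≢[]
  ... | r , m , refl rewrite raiseLast-∷ʳ-down r m = lift-arch-∷ʳ r m hδ

  lift-injective : ∀ {δ′} → H δ → δ ≢ [] → H δ′ → δ′ ≢ [] → lift δ ≡ lift δ′ → δ ≡ δ′
  lift-injective hδ δ≢[] hδ′ δ′≢[] eq with H-ends-down hδ δ≢[] | H-ends-down hδ′ δ′≢[]
  ... | r , m , refl | r′ , m′ , refl = trans (sym (lower-lift r m)) (trans (cong lower eq) (lower-lift r′ m′))

  arch-cases : Arch α → α ≡ UD ⊎ ∃[ δ ] H δ × δ ≢ [] × α ≡ lift δ
  arch-cases (_ , inj₁ α≡UD) = inj₁ α≡UD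
  arch-cases (_ , inj₂ (((_ , w , _) , _ , m , α′ , refl) , hα♭)) = inj₂ (unlower α′ w hα♭)
    where
    unlower : ∀ α′ → Walk 0 (α′ ++ [ down (suc m) ]) 0 → H (lower (α′ ++ [ down (suc m) ])) →
              ∃[ δ ] H δ × δ ≢ [] × α′ ++ [ down (suc m) ] ≡ lift δ
    unlower []      (dn _ () _) _
    unlower (s ∷ r) w hα♭ with walk-from-0-starts-U w
    ... | refl = r ++ [ down m ] , subst H (lowerLast-∷ʳ-down r m) hα♭ , ∷ʳ≢[] r
               , cong (U ∷_) (sym (raiseLast-∷ʳ-down r m))
      where
      ∷ʳ≢[] : ∀ r → r ++ [ down m ] ≢ []
      ∷ʳ≢[] []      ()
      ∷ʳ≢[] (_ ∷ _) ()

module Enumerations where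

  open import Data.Empty using (⊥-elim)
  open import Data.List using (List; []; _∷_; _++_; map; length; cartesianProduct)
  import Data.List.Properties as List
  open import Data.List.Membership.Propositional using (_∈_)
  open import Data.List.Membership.Propositional.Properties
  open import Data.List.Membership.Propositional.Properties.WithK using (unique∧set⇒bag)
  open import Data.List.Relation.Binary.BagAndSetEquality using (∼bag⇒↭)
  open import Data.List.Relation.Binary.Permutation.Propositional.Properties using (↭-length)
  open import Data.List.Relation.Unary.All as All using ([]; _∷_)
  import Data.List.Relation.Unary.All.Properties as All
  open import Data.List.Relation.Unary.Any using (here; there)
  open import Data.List.Relation.Unary.Unique.Propositional using (Unique; []; _∷_)
  import Data.List.Relation.Unary.Unique.Propositional.Properties as Unique
  open import Data.Nat using (ℕ; zero; suc; pred; _+_; _*_; _<_; z≤n; s≤s)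
  open import Data.Nat.Properties using (0≢1+n)
  open import Data.Product using (Σ-syntax; ∃; ∃-syntax; _×_; _,_; proj₁; proj₂)
  open import Data.Sum using (_⊎_; inj₁; inj₂)
  open import Function using (_∘_)
  open import Function.Bundles using (_⇔_; mk⇔; Equivalence)
  open import Relation.Binary.PropositionalEquality
  open import Relation.Nullary using (¬_)

  open Equivalence using (to; from)

  record Enumeration {A : Set} (P : A → Set) (k : ℕ) : Set where
    constructor enumeration
    field
      elements : List A
      unique   : Unique elements
      members  : ∀ x → x ∈ elements ⇔ P x
      size     : length elements ≡ k
  open Enumeration

  Finite : {A : Set} → (A → Set) → Set
  Finite P = ∃ (Enumeration P)

  ∑ℕ : ℕ → (ℕ → ℕ) → ℕ
  ∑ℕ zero    c = 0
  ∑ℕ (suc n) c = c 0 + ∑ℕ n (c ∘ suc)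

  module _ {A : Set} where

    enumeration-size-unique : ∀ {P : A → Set} {k k′} → Enumeration P k → Enumeration P k′ → k ≡ k′
    enumeration-size-unique (enumeration xs xs! xs∈ refl) (enumeration ys ys! ys∈ refl) =
      ↭-length (∼bag⇒↭ (unique∧set⇒bag xs! ys! (λ {x} → mk⇔ (from (ys∈ x) ∘ to (xs∈ x)) (from (xs∈ x) ∘ to (ys∈ x)))))

    enumeration-⇔ : ∀ {P Q : A → Set} {k} → (∀ x → P x ⇔ Q x) → Enumeration P k → Enumeration Q k
    enumeration-⇔ P⇔Q (enumeration xs xs! xs∈ size) =
      enumeration xs xs! (λ x → mk⇔ (to (P⇔Q x) ∘ to (xs∈ x)) (from (xs∈ x) ∘ from (P⇔Q x))) size

    enumeration-∅ : ∀ {P : A → Set} → (∀ x → ¬ P x) → Enumeration P 0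
    enumeration-∅ ¬P = enumeration [] [] (λ x → mk⇔ (λ ()) (⊥-elim ∘ ¬P x)) refl

    enumeration-singleton : ∀ {P : A → Set} a → (∀ x → P x ⇔ x ≡ a) → Enumeration P 1
    enumeration-singleton a P⇔≡a = enumeration (a ∷ []) ([] ∷ [])
      (λ x → mk⇔ (λ { (here refl) → from (P⇔≡a x) refl }) (here ∘ to (P⇔≡a x))) refl

    enumeration-⊎ : ∀ {P Q : A → Set} {a b} → Enumeration P a → Enumeration Q b →
                    (∀ x → P x → ¬ Q x) → Enumeration (λ x → P x ⊎ Q x) (a + b)
    enumeration-⊎ {P} {Q} (enumeration xs xs! xs∈ refl) (enumeration ys ys! ys∈ refl) disjoint =
      enumeration (xs ++ ys) (Unique.++⁺ xs! ys! (λ {x} (x∈xs , x∈ys) → disjoint x (to (xs∈ x) x∈xs) (to (ys∈ x) x∈ys)))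
                  (λ x → mk⇔ (split x) (join x)) (List.length-++ xs)
      where
      split : ∀ x → x ∈ xs ++ ys → P x ⊎ Q x
      split x x∈ with ∈-++⁻ xs x∈
      ... | inj₁ x∈xs = inj₁ (to (xs∈ x) x∈xs)
      ... | inj₂ x∈ys = inj₂ (to (ys∈ x) x∈ys)
      join : ∀ x → P x ⊎ Q x → x ∈ xs ++ ys
      join x (inj₁ px) = ∈-++⁺ˡ (from (xs∈ x) px)
      join x (inj₂ qx) = ∈-++⁺ʳ xs (from (ys∈ x) qx)

    enumeration-⋃< : ∀ n {P : ℕ → A → Set} {c : ℕ → ℕ} → (∀ j → j < n → Enumeration (P j) (c j)) →
                     (∀ i j x → P i x → P j x → i ≡ j) →
                     Enumeration (λ x → ∃[ j ] j < n × P j x) (∑ℕ n c)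
    enumeration-⋃< zero    _     _        = enumeration-∅ (λ { x (j , () , _) })
    enumeration-⋃< (suc n) {P} enums disjoint = enumeration-⇔ first-or-later
      (enumeration-⊎ (enums 0 (s≤s z≤n))
                     (enumeration-⋃< n (λ j j<n → enums (suc j) (s≤s j<n))
                                       (λ i j x pi pj → cong pred (disjoint (suc i) (suc j) x pi pj)))
                     (λ { x p₀ (j , _ , pj) → 0≢1+n (disjoint 0 (suc j) x p₀ pj) }))
      where
      first-or-later : ∀ x → (P 0 x ⊎ ∃[ j ] j < n × P (suc j) x) ⇔ (∃[ j ] j < suc n × P j x)
      first-or-later x = mk⇔ (λ { (inj₁ p₀) → 0 , s≤s z≤n , p₀ ; (inj₂ (j , j<n , pj)) → suc j , s≤s j<n , pj })
                             (λ { (zero , _ , p₀) → inj₁ p₀ ; (suc j , s≤s j<n , pj) → inj₂ (j , j<n , pj) })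

  module _ {A B : Set} where

    enumeration-image : ∀ {P : A → Set} {k} (f : A → B) → Enumeration P k →
                        (∀ {x y} → P x → P y → f x ≡ f y → x ≡ y) →
                        Enumeration (λ z → ∃[ x ] P x × z ≡ f x) k
    enumeration-image {P} f (enumeration xs xs! xs∈ size) f-inj =
      enumeration (map f xs) (map-unique xs! (λ x∈ y∈ → f-inj (to (xs∈ _) x∈) (to (xs∈ _) y∈)))
                  (λ z → mk⇔ preimage (λ { (x , px , refl) → ∈-map⁺ f (from (xs∈ x) px) }))
                  (trans (List.length-map f xs) size)
      where
      preimage : ∀ {z} → z ∈ map f xs → ∃[ x ] P x × z ≡ f x
      preimage z∈ with ∈-map⁻ f z∈
      ... | x , x∈xs , refl = x , to (xs∈ x) x∈xs , refl
      map-unique : ∀ {xs} → Unique xs → (∀ {x y} → x ∈ xs → y ∈ xs → f x ≡ f y → x ≡ y) → Unique (map f xs)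
      map-unique []          _     = []
      map-unique (x∉ ∷ xs!) f-inj′ =
        All.map⁺ (All.tabulate (λ y∈ fx≡fy → All.lookup x∉ y∈ (f-inj′ (here refl) (there y∈) fx≡fy)))
        ∷ map-unique xs! (λ x∈ y∈ → f-inj′ (there x∈) (there y∈))

    length-cartesianProduct : ∀ (xs : List A) (ys : List B) → length (cartesianProduct xs ys) ≡ length xs * length ys
    length-cartesianProduct []       ys = refl
    length-cartesianProduct (x ∷ xs) ys =
      trans (List.length-++ (map (x ,_) ys)) (cong₂ _+_ (List.length-map (x ,_) ys) (length-cartesianProduct xs ys))

    enumeration-× : ∀ {P : A → Set} {Q : B → Set} {a b} → Enumeration P a → Enumeration Q b →
                    Enumeration (λ xy → P (proj₁ xy) × Q (proj₂ xy)) (a * b)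
    enumeration-× (enumeration xs xs! xs∈ refl) (enumeration ys ys! ys∈ refl) =
      enumeration (cartesianProduct xs ys) (Unique.cartesianProduct⁺ xs! ys!)
        (λ { (x , y) → mk⇔ (λ xy∈ → let (x∈ , y∈) = ∈-cartesianProduct⁻ xs ys xy∈ in to (xs∈ x) x∈ , to (ys∈ y) y∈)
                           (λ (px , qy) → ∈-cartesianProduct⁺ (from (xs∈ x) px) (from (ys∈ y) qy)) })
        (length-cartesianProduct xs ys)

  finite-choice : ∀ n {A : Set} {P : ℕ → A → Set} → (∀ j → j < n → Finite (P j)) →
                  Σ[ c ∈ (ℕ → ℕ) ] ∀ j → j < n → Enumeration (P j) (c j)
  finite-choice zero    fin = (λ _ → 0) , (λ _ ())
  finite-choice (suc n) {P = P} fin = c , enums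
    where
    later : Σ[ c ∈ (ℕ → ℕ) ] ∀ j → j < n → Enumeration (P (suc j)) (c j)
    later = finite-choice n (λ j j<n → fin (suc j) (s≤s j<n))
    c : ℕ → ℕ
    c zero    = proj₁ (fin 0 (s≤s z≤n))
    c (suc j) = proj₁ later j
    enums : ∀ j → j < suc n → Enumeration (P j) (c j)
    enums zero    _         = proj₂ (fin 0 (s≤s z≤n))
    enums (suc j) (s≤s j<n) = proj₂ later j j<n

module HeightCounts where

  open import Defs
  open Paths
  open Enumerations
  open import Data.Empty using (⊥-elim)
  open import Data.List using (List; []; _∷_; _++_; length)
  import Data.List.Properties as List
  open import Data.Nat using (ℕ; zero; suc; _∸_; _≤_; _<_; _+_; _*_; z≤n; s≤s)
  import Data.Nat.Properties as ℕ
  open import Data.Nat.Induction using (<-rec)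
  open import Data.Product using (∃-syntax; _×_; _,_; proj₁; proj₂)
  open import Data.Sum using (_⊎_; inj₁; inj₂)
  open import Function using (case_of_)
  open import Function.Bundles using (_⇔_; mk⇔)
  import Function.Properties.Equivalence as ⇔
  open import Relation.Binary.PropositionalEquality hiding ([_])
  open import Relation.Nullary using (¬_)

  H≤ : ℕ → ℕ → List Step → Set
  H≤ g n γ = H γ × length γ ≡ n × ht γ ≤ g

  H≡ : ℕ → ℕ → List Step → Set
  H≡ g n γ = H γ × length γ ≡ n × ht γ ≡ g

  Arch≡ : ℕ → ℕ → List Step → Set
  Arch≡ g n α = Arch α × length α ≡ n × ht α ≡ g

  H≤-length : ∀ {g n γ} → n ≤ g → (H γ × length γ ≡ n) ⇔ H≤ g n γ
  H≤-length {γ = γ} n≤g = mk⇔ (λ { (hγ , refl) → hγ , refl , ℕ.≤-trans (ht≤length γ) n≤g })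
                      (λ { (hγ , len , _) → hγ , len })

  δ₀ : ℕ → ℕ
  δ₀ zero    = 1
  δ₀ (suc _) = 0

  enum-H≤-0 : ∀ n → Enumeration (H≤ 0 n) (δ₀ n)
  enum-H≤-0 zero    = enumeration-singleton [] (λ γ → mk⇔ only-[] (λ { refl → empty , refl , z≤n }))
    where
    only-[] : ∀ {γ} → H≤ 0 0 γ → γ ≡ []
    only-[] {[]} _ = refl
  enum-H≤-0 (suc n) = enumeration-∅ flat-is-empty
    where
    flat-is-empty : ∀ γ → ¬ H≤ 0 (suc n) γ
    flat-is-empty (s ∷ γ) (hγ , _ , ht≤0) with () ← ℕ.≤-trans (H-ht-positive hγ (λ ())) ht≤0

  enum-H≤-suc : ∀ {g n a b} → Enumeration (H≤ g n) a → Enumeration (H≡ (suc g) n) b →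
                Enumeration (H≤ (suc g) n) (a + b)
  enum-H≤-suc {g} {n} low exact = enumeration-⇔ below-or-at (enumeration-⊎ low exact disjoint)
    where
    disjoint : ∀ γ → H≤ g n γ → ¬ H≡ (suc g) n γ
    disjoint γ (_ , _ , ht≤g) (_ , _ , ht≡1+g) = ℕ.<-irrefl ht≡1+g (s≤s ht≤g)
    below-or-at : ∀ γ → (H≤ g n γ ⊎ H≡ (suc g) n γ) ⇔ H≤ (suc g) n γ
    below-or-at γ = mk⇔ (λ { (inj₁ (hγ , len , ht≤g)) → hγ , len , ℕ.m≤n⇒m≤1+n ht≤g
                           ; (inj₂ (hγ , len , ht≡1+g)) → hγ , len , ℕ.≤-reflexive ht≡1+g })
                        (λ { (hγ , len , ht≤1+g) → split hγ len ht≤1+g })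
      where
      split : H γ → length γ ≡ n → ht γ ≤ suc g → H≤ g n γ ⊎ H≡ (suc g) n γ
      split hγ len ht≤1+g with ℕ.m≤n⇒m<n∨m≡n ht≤1+g
      ... | inj₁ (s≤s ht≤g) = inj₁ (hγ , len , ht≤g)
      ... | inj₂ ht≡1+g     = inj₂ (hγ , len , ht≡1+g)

  ArchThenH : ℕ → ℕ → ℕ → List Step → Set
  ArchThenH g n j γ = ∃[ αβ ] (Arch≡ (suc g) (suc j) (proj₁ αβ) × H≤ (suc g) (n ∸ suc j) (proj₂ αβ))
                              × γ ≡ proj₁ αβ ++ proj₂ αβ

  enum-ArchThenH : ∀ {g n j a b} → Enumeration (Arch≡ (suc g) (suc j)) a → Enumeration (H≤ (suc g) (n ∸ suc j)) b →
                   Enumeration (ArchThenH g n j) (a * b)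
  enum-ArchThenH arches rests = enumeration-image concat (enumeration-× arches rests) concat-injective
    where
    concat : List Step × List Step → List Step
    concat (α , β) = α ++ β
    concat-injective : ∀ {αβ α′β′} → _ → _ → concat αβ ≡ concat α′β′ → αβ ≡ α′β′
    concat-injective {α , β} ((a , _) , _) ((a′ , _) , _) eq with arch-prefix-unique a a′ eq
    ... | refl with List.++-cancelˡ α β _ eq
    ... | refl = refl

  H≡-decompose : ∀ {g n γ} → H≡ (suc g) n γ → ∃[ j ] j < n × ArchThenH g n j γ
  H≡-decompose {g} {n} (hγ , len , htγ) with H-decompose hγ (λ { refl → case htγ of λ () })
  ... | [] , β , _ , a , _ = ⊥-elim (arch-nonempty a refl)
  ... | s ∷ α , β , refl , a , hβ , hβ≤hα = length α , j<n , (s ∷ α , β) , ((a , refl , htα) , (hβ , lenβ , hβ≤1+g)) , refl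
    where
    htα : ht (s ∷ α) ≡ suc g
    htα = trans (sym (ht-arch-++ a hβ≤hα)) htγ
    hβ≤1+g : ht β ≤ suc g
    hβ≤1+g = subst (ht β ≤_) htα hβ≤hα
    lengths : suc (length α) + length β ≡ n
    lengths = trans (sym (List.length-++ (s ∷ α))) len
    j<n : length α < n
    j<n = subst (suc (length α) ≤_) lengths (ℕ.m≤m+n (suc (length α)) (length β))
    lenβ : length β ≡ n ∸ suc (length α)
    lenβ = trans (sym (ℕ.m+n∸m≡n (suc (length α)) (length β))) (cong (_∸ suc (length α)) lengths)

  enum-H≡ : ∀ {g n} {a b : ℕ → ℕ} → (∀ j → j < n → Enumeration (Arch≡ (suc g) (suc j)) (a j)) →
            (∀ j → j < n → Enumeration (H≤ (suc g) (n ∸ suc j)) (b j)) →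
            Enumeration (H≡ (suc g) n) (∑ℕ n (λ j → a j * b j))
  enum-H≡ {g} {n} arches rests =
    enumeration-⇔ (λ γ → mk⇔ concatenate H≡-decompose)
      (enumeration-⋃< n (λ j j<n → enum-ArchThenH {n = n} (arches j j<n) (rests j j<n)) arch-length-unique)
    where
    arch-length-unique : ∀ i j γ → ArchThenH g n i γ → ArchThenH g n j γ → i ≡ j
    arch-length-unique i j γ ((α , β) , ((a , lenα , _) , _) , refl) ((α′ , β′) , ((a′ , lenα′ , _) , _) , eq)
      with arch-prefix-unique a a′ eq
    ... | refl = ℕ.suc-injective (trans (sym lenα) lenα′)
    concatenate : ∀ {γ} → ∃[ j ] j < n × ArchThenH g n j γ → H≡ (suc g) n γ
    concatenate (j , j<n , (α , β) , ((a , lenα , htα) , (hβ , lenβ , hβ≤1+g)) , refl) =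
      H-++ a hβ hβ≤hα , lengths , trans (ht-arch-++ a hβ≤hα) htα
      where
      hβ≤hα = subst (ht β ≤_) (sym htα) hβ≤1+g
      lengths = trans (List.length-++ α) (trans (cong₂ _+_ lenα lenβ) (ℕ.m+[n∸m]≡n j<n))

  height-1-arch-is-UD : ∀ {n α} → Arch≡ 1 n α → α ≡ UD
  height-1-arch-is-UD (a , _ , htα) with arch-cases a
  ... | inj₁ α≡UD = α≡UD
  ... | inj₂ (δ , hδ , δ≢[] , refl)
    with () ← subst (1 ≤_) (ℕ.suc-injective (trans (sym (proj₂ (lift-arch hδ δ≢[]))) htα)) (H-ht-positive hδ δ≢[])

  height-1-arch-length : ∀ {n α} → Arch≡ 1 n α → n ≡ 2
  height-1-arch-length a@(_ , len , _) = trans (sym len) (cong length (height-1-arch-is-UD a))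

  δ₂ : ℕ → ℕ
  δ₂ 2 = 1
  δ₂ _ = 0

  enum-Arch≡-1 : ∀ n → Enumeration (Arch≡ 1 n) (δ₂ n)
  enum-Arch≡-1 2                   =
    enumeration-singleton UD (λ α → mk⇔ height-1-arch-is-UD (λ { refl → UD-arch , refl , refl }))
  enum-Arch≡-1 0                   = enumeration-∅ (λ α a → case height-1-arch-length a of λ ())
  enum-Arch≡-1 1                   = enumeration-∅ (λ α a → case height-1-arch-length a of λ ())
  enum-Arch≡-1 (suc (suc (suc n))) = enumeration-∅ (λ α a → case height-1-arch-length a of λ ())

  enum-Arch≡-lift : ∀ {g k a} → Enumeration (H≡ (suc g) k) a → Enumeration (Arch≡ (suc (suc g)) (suc k)) a
  enum-Arch≡-lift {g} {k} exact = enumeration-⇔ lifts (enumeration-image lift exact lift-injective′)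
    where
    nonempty : ∀ {δ} → H≡ (suc g) k δ → δ ≢ []
    nonempty (_ , _ , ()) refl
    lift-injective′ : ∀ {δ δ′} → H≡ (suc g) k δ → H≡ (suc g) k δ′ → lift δ ≡ lift δ′ → δ ≡ δ′
    lift-injective′ e@(hδ , _) e′@(hδ′ , _) = lift-injective hδ (nonempty e) hδ′ (nonempty e′)
    lifts : ∀ α → (∃[ δ ] H≡ (suc g) k δ × α ≡ lift δ) ⇔ Arch≡ (suc (suc g)) (suc k) α
    lifts α = mk⇔ lifted unlifted
      where
      lifted : ∃[ δ ] H≡ (suc g) k δ × α ≡ lift δ → Arch≡ (suc (suc g)) (suc k) α
      lifted (δ , e@(hδ , len , htδ) , refl) =
        let (a , ht-lift) = lift-arch hδ (nonempty e)
        in a , trans (length-lift δ) (cong suc len) , trans ht-lift (cong suc htδ)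
      unlifted : Arch≡ (suc (suc g)) (suc k) α → ∃[ δ ] H≡ (suc g) k δ × α ≡ lift δ
      unlifted (a , len , htα) with arch-cases a
      ... | inj₁ refl with () ← htα
      ... | inj₂ (δ , hδ , δ≢[] , refl) =
        δ , (hδ , ℕ.suc-injective (trans (sym (length-lift δ)) len)
                , ℕ.suc-injective (trans (sym (proj₂ (lift-arch hδ δ≢[]))) htα)) , refl

  enum-Arch≡-length-0 : ∀ {g} → Enumeration (Arch≡ g 0) 0
  enum-Arch≡-length-0 = enumeration-∅ λ { [] (a , _ , _) → arch-nonempty a refl }

  record FiniteAtLength (n : ℕ) : Set where
    field
      lows   : ∀ g → Finite (H≤ g n)
      exacts : ∀ g → Finite (H≡ (suc g) n)
      arches : ∀ g → Finite (Arch≡ (suc g) n)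
  open FiniteAtLength

  -- By strong induction on n: an arch of length j + 1 is followed by a path of length n − (j + 1) < n,
  -- and an arch of height g + 2 and length n is the lift of a path of length n − 1.
  finiteAtLength : ∀ n → FiniteAtLength n
  finiteAtLength = <-rec FiniteAtLength step
    where
    higher-arches : ∀ n → (∀ {m} → m < n → FiniteAtLength m) → ∀ g → Finite (Arch≡ (suc (suc g)) n)
    higher-arches zero    _       g = _ , enum-Arch≡-length-0
    higher-arches (suc k) shorter g = _ , enum-Arch≡-lift (proj₂ (exacts (shorter ℕ.≤-refl) g))
    step : ∀ n → (∀ {m} → m < n → FiniteAtLength m) → FiniteAtLength n
    step n shorter = record { lows = lows′ ; exacts = exacts′ ; arches = arches′ }
      where
      arches′ : ∀ g → Finite (Arch≡ (suc g) n)
      arches′ zero    = _ , enum-Arch≡-1 n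
      arches′ (suc g) = higher-arches n shorter g
      arches≤ : ∀ m → m ≤ n → ∀ g → Finite (Arch≡ (suc g) m)
      arches≤ m m≤n with ℕ.m≤n⇒m<n∨m≡n m≤n
      ... | inj₁ m<n  = arches (shorter m<n)
      ... | inj₂ refl = arches′
      exacts′ : ∀ g → Finite (H≡ (suc g) n)
      exacts′ g with finite-choice n (λ j j<n → arches≤ (suc j) j<n g)
                   | finite-choice n (λ j j<n → lows (shorter (ℕ.∸-monoʳ-< (s≤s z≤n) j<n)) (suc g))
      ... | _ , archEnums | _ , restEnums = _ , enum-H≡ archEnums restEnums
      lows′ : ∀ g → Finite (H≤ g n)
      lows′ zero    = _ , enum-H≤-0 n
      lows′ (suc g) = _ , enum-H≤-suc (proj₂ (lows′ g)) (proj₂ (exacts′ g))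

  F E A : ℕ → ℕ → ℕ
  F g n = proj₁ (lows   (finiteAtLength n) g)
  E g n = proj₁ (exacts (finiteAtLength n) g)
  A g n = proj₁ (arches (finiteAtLength n) g)

  enum-F : ∀ g n → Enumeration (H≤ g n) (F g n)
  enum-F g n = proj₂ (lows (finiteAtLength n) g)

  enum-E : ∀ g n → Enumeration (H≡ (suc g) n) (E g n)
  enum-E g n = proj₂ (exacts (finiteAtLength n) g)

  enum-A : ∀ g n → Enumeration (Arch≡ (suc g) n) (A g n)
  enum-A g n = proj₂ (arches (finiteAtLength n) g)

  F-zero : ∀ n → F 0 n ≡ δ₀ n
  F-zero n = enumeration-size-unique (enum-F 0 n) (enum-H≤-0 n)

  F-suc : ∀ g n → F (suc g) n ≡ F g n + E g n
  F-suc g n = enumeration-size-unique (enum-F (suc g) n) (enum-H≤-suc (enum-F g n) (enum-E g n))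

  E-first-arch : ∀ g n → E g n ≡ ∑ℕ n (λ j → A g (suc j) * F (suc g) (n ∸ suc j))
  E-first-arch g n = enumeration-size-unique (enum-E g n)
    (enum-H≡ (λ j _ → enum-A g (suc j)) (λ j _ → enum-F (suc g) (n ∸ suc j)))

  A-zero : ∀ n → A 0 n ≡ δ₂ n
  A-zero n = enumeration-size-unique (enum-A 0 n) (enum-Arch≡-1 n)

  A-suc : ∀ g k → A (suc g) (suc k) ≡ E g k
  A-suc g k = enumeration-size-unique (enum-A (suc g) (suc k)) (enum-Arch≡-lift (enum-E g k))

  F-stable : ∀ {g n} → n ≤ g → F g n ≡ F n n
  F-stable {g} {n} n≤g = enumeration-size-unique (enum-F g n)
    (enumeration-⇔ (λ γ → ⇔.trans (⇔.sym (H≤-length ℕ.≤-refl)) (H≤-length n≤g))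
                   (enum-F n n))

  F-counts-H : ∀ n {k} → Enumeration (λ γ → H γ × length γ ≡ n) k → k ≡ F n n
  F-counts-H n enum =
    enumeration-size-unique enum (enumeration-⇔ (λ γ → ⇔.sym (H≤-length ℕ.≤-refl)) (enum-F n n))

module GeneratingFunctions where

  open import Defs using (Series)
  open PowerSeries
  open Enumerations using (∑ℕ)
  open HeightCounts using (F; E; A; δ₀; δ₂; F-zero; F-suc; E-first-arch; A-zero; A-suc; F-stable)
  open import Data.Nat as ℕ using (ℕ; zero; suc; _∸_; _≤_)
  import Data.Nat.Properties as ℕ
  open import Data.Integer using (_+_; -_; 1ℤ; +_)
  open import Data.Integer.Properties using (pos-+; pos-*; +-identityʳ)
  open import Function using (_∘_; case_of_)
  open import Relation.Binary.PropositionalEquality using (_≡_; refl; sym; trans; cong)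
  open import Algebra.Bundles using (CommutativeRing)
  open CommutativeRing seriesRing using (setoid)
  open import Relation.Binary.Reasoning.Setoid setoid

  -- Aˢ g n counts the arches of height g + 1 and length n + 1.
  Fˢ Eˢ Aˢ : ℕ → Series
  Fˢ g n = + F g n
  Eˢ g n = + E g n
  Aˢ g n = + A g (suc n)

  Fˢ-zero : Fˢ 0 ≈ 𝟙
  Fˢ-zero = coeffs λ n → trans (cong +_ (F-zero n)) (δ₀≡ n)
    where
    δ₀≡ : ∀ n → + δ₀ n ≡ 𝟙 n
    δ₀≡ zero    = refl
    δ₀≡ (suc n) = refl

  Fˢ-suc : ∀ g → Fˢ (suc g) ≈ Fˢ g ⊕ Eˢ g
  Fˢ-suc g = coeffs λ n → trans (cong +_ (F-suc g n)) (pos-+ (F g n) (E g n))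

  ∑ℕ-convolution : ∀ (a b : ℕ → ℕ) n → + ∑ℕ n (λ j → a j ℕ.* b (n ∸ suc j)) ≡ shift ((+_ ∘ a) ⊗ (+_ ∘ b)) n
  ∑ℕ-convolution a b zero    = refl
  ∑ℕ-convolution a b (suc n) =
    trans (pos-∑ℕ (suc n) (λ j → a j ℕ.* b (n ∸ j))) (∑-cong (suc n) (λ j _ → pos-* (a j) (b (n ∸ j))))
    where
    pos-∑ℕ : ∀ n (c : ℕ → ℕ) → + ∑ℕ n c ≡ ∑ n (+_ ∘ c)
    pos-∑ℕ zero    c = refl
    pos-∑ℕ (suc n) c = trans (pos-+ (c 0) _) (cong (_+_ (+ c 0)) (pos-∑ℕ n (c ∘ suc)))

  Eˢ-first-arch : ∀ g → Eˢ g ≈ X ⊗ (Aˢ g ⊗ Fˢ (suc g))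
  Eˢ-first-arch g = ≈-trans
    (coeffs λ n → trans (cong +_ (E-first-arch g n)) (∑ℕ-convolution (A g ∘ suc) (F (suc g)) n))
    (≈-sym (X-⊗ (Aˢ g ⊗ Fˢ (suc g))))

  -- G 0 = 1 − x plays the role of F₋₁: it makes G-recurrence hold at g = 0 as well.
  G : ℕ → Series
  G zero    = 𝟙 ⊕ ⊖ X
  G (suc g) = Fˢ g

  Aˢ-difference : ∀ g → Aˢ g ≈ G (suc g) ⊕ ⊖ G g
  Aˢ-difference zero = begin
    Aˢ 0                     ≈⟨ coeffs (λ n → trans (cong +_ (A-zero (suc n))) (δ₂≡ n)) ⟩
    X                        ≈⟨ solve 1 (λ x → x := con 1ℤ :- (con 1ℤ :- x)) ≈-refl X ⟩
    𝟙 ⊕ ⊖ (𝟙 ⊕ ⊖ X)          ≈⟨ ⊕-congˡ (⊖ (𝟙 ⊕ ⊖ X)) Fˢ-zero ⟨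
    Fˢ 0 ⊕ ⊖ (𝟙 ⊕ ⊖ X)       ∎
    where
    δ₂≡ : ∀ n → + δ₂ (suc n) ≡ X n
    δ₂≡ 0             = refl
    δ₂≡ 1             = refl
    δ₂≡ (suc (suc n)) = refl
  Aˢ-difference (suc g) = begin
    Aˢ (suc g)                ≈⟨ coeffs (λ n → cong +_ (A-suc g n)) ⟩
    Eˢ g                      ≈⟨ solve 2 (λ e f → e := (f :+ e) :- f) ≈-refl (Eˢ g) (Fˢ g) ⟩
    (Fˢ g ⊕ Eˢ g) ⊕ ⊖ Fˢ g    ≈⟨ ⊕-congˡ (⊖ Fˢ g) (Fˢ-suc g) ⟨
    Fˢ (suc g) ⊕ ⊖ Fˢ g       ∎

  G-recurrence : ∀ g → G (suc (suc g)) ≈ G (suc g) ⊕ X ⊗ ((G (suc g) ⊕ ⊖ G g) ⊗ G (suc (suc g)))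
  G-recurrence g = begin
    Fˢ (suc g)                                ≈⟨ Fˢ-suc g ⟩
    Fˢ g ⊕ Eˢ g                               ≈⟨ ⊕-congʳ (Fˢ g) (Eˢ-first-arch g) ⟩
    Fˢ g ⊕ X ⊗ (Aˢ g ⊗ Fˢ (suc g))            ≈⟨ ⊕-congʳ (Fˢ g) (⊗-congʳ X (⊗-congˡ (Fˢ (suc g)) (Aˢ-difference g))) ⟩
    Fˢ g ⊕ X ⊗ ((G (suc g) ⊕ ⊖ G g) ⊗ Fˢ (suc g)) ∎

  P : Series → Series
  P d = 𝟙 ⊕ ⊖ x³ ⊕ ⊖ (x² ⊗ d)

  G-constant : ∀ g → G (suc g) 0 ≡ 1ℤ
  G-constant zero    = coeff Fˢ-zero 0
  -- The constant term of X ⊗ _ reduces to 0ℤ.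
  G-constant (suc g) = trans (coeff (G-recurrence g) 0) (trans (+-identityʳ (G (suc g) 0)) (G-constant g))

  G-inverse : ∀ g → G (suc (suc g)) ⊗ P (G g) ≈ 𝟙
  G-inverse zero = ≈-from-difference (≈-trans (base (G 2) (G 1) X)
    (⊕-≈𝟘 (difference-≈𝟘 (G-recurrence 0)) (⊗-≈𝟘 (𝟙 ⊕ X ⊗ G 2) (difference-≈𝟘 Fˢ-zero))))
    where
    base : ∀ b c x → b ⊗ (𝟙 ⊕ ⊖ (x ⊗ (x ⊗ x)) ⊕ ⊖ (x ⊗ x ⊗ (𝟙 ⊕ ⊖ x))) ⊕ ⊖ 𝟙
                   ≈ (b ⊕ ⊖ (c ⊕ x ⊗ ((c ⊕ ⊖ (𝟙 ⊕ ⊖ x)) ⊗ b))) ⊕ (𝟙 ⊕ x ⊗ b) ⊗ (c ⊕ ⊖ 𝟙)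
    base = solve 3 (λ b c x →
      b :* (con 1ℤ :- x :* (x :* x) :- x :* x :* (con 1ℤ :- x)) :- con 1ℤ
      := (b :- (c :+ x :* ((c :- (con 1ℤ :- x)) :* b))) :+ (con 1ℤ :+ x :* b) :* (c :- con 1ℤ)) ≈-refl
  G-inverse (suc g) = ≈-from-difference (⊗-cancelʳ _ b
    (≈-trans (step a b c d X)
      (⊕-≈𝟘 (⊕-≈𝟘 (⊗-≈𝟘 a (difference-≈𝟘 (G-inverse g))) (difference-≈𝟘 (G-recurrence (suc g))))
            (⊗-≈𝟘 (X ⊗ a) (difference-≈𝟘 (G-recurrence g)))))
    (λ b₀≡0 → case trans (sym (G-constant (suc g))) b₀≡0 of λ ()))
    where
    a = G (suc (suc (suc g)))
    b = G (suc (suc g))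
    c = G (suc g)
    d = G g
    step : ∀ a b c d x →
      (a ⊗ (𝟙 ⊕ ⊖ (x ⊗ (x ⊗ x)) ⊕ ⊖ (x ⊗ x ⊗ c)) ⊕ ⊖ 𝟙) ⊗ b
      ≈ a ⊗ (b ⊗ (𝟙 ⊕ ⊖ (x ⊗ (x ⊗ x)) ⊕ ⊖ (x ⊗ x ⊗ d)) ⊕ ⊖ 𝟙)
        ⊕ (a ⊕ ⊖ (b ⊕ x ⊗ ((b ⊕ ⊖ c) ⊗ a)))
        ⊕ x ⊗ a ⊗ (b ⊕ ⊖ (c ⊕ x ⊗ ((c ⊕ ⊖ d) ⊗ b)))
    step = solve 5 (λ a b c d x →
      (a :* (con 1ℤ :- x :* (x :* x) :- x :* x :* c) :- con 1ℤ) :* b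
      := a :* (b :* (con 1ℤ :- x :* (x :* x) :- x :* x :* d) :- con 1ℤ)
         :+ (a :- (b :+ x :* ((b :- c) :* a)))
         :+ x :* a :* (b :- (c :+ x :* ((c :- d) :* b)))) ≈-refl

  B : Series
  B n = + F n n

  B-agrees : ∀ {g n} → n ≤ g → B ≡[≤ n ] Fˢ g
  B-agrees n≤g i i≤n = cong +_ (sym (F-stable (ℕ.≤-trans i≤n n≤g)))

  P-cong-≤ : ∀ {n d d′} → d ≡[≤ n ] d′ → P d ≡[≤ n ] P d′
  P-cong-≤ d≡d′ =
    ⊕-cong-≤ {f = 𝟙 ⊕ ⊖ x³} (λ _ _ → refl) (⊖-cong-≤ (⊗-cong-≤ {f = x²} (λ _ _ → refl) d≡d′))

  -- Up to degree n, B agrees with both Fˢ (n + 2) and Fˢ n, so G-inverse (suc n) gives the n-th coefficient.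
  B-inverse : B ⊗ P B ≈ 𝟙
  B-inverse = coeffs λ n → trans
    (⊗-cong-≤ (B-agrees (ℕ.m≤n+m n 2)) (P-cong-≤ (B-agrees ℕ.≤-refl)) n ℕ.≤-refl)
    (coeff (G-inverse (suc n)) n)

module Quadratic where

  open import Defs using (Series; _⊛_; disc; oneMinusX3; numer)
  open PowerSeries
  open GeneratingFunctions using (B; B-inverse)
  open import Data.Nat using (suc)
  open import Data.Integer using (_+_; _*_; -_; 0ℤ; 1ℤ; +_)
  open import Data.Integer.Properties using (*-zeroʳ; *-cancelˡ-≡)
  open import Data.Integer.Tactic.RingSolver using (solve-∀)
  open import Relation.Binary.PropositionalEquality using (_≡_; _≢_; refl; sym; trans; cong; cong₂; module ≡-Reasoning)
  open ≡-Reasoning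

  quadratic-root-unique : ∀ c {N T} → N ⊗ N ⊕ ⊖ (c ⊗ N) ≈ T ⊗ T ⊕ ⊖ (c ⊗ T) → (N ⊕ T ⊕ ⊖ c) 0 ≢ 0ℤ → N ≈ T
  quadratic-root-unique c {N} {T} same-value E₀≢0 = ≈-from-difference
    (⊗-cancelʳ (N ⊕ ⊖ T) (N ⊕ T ⊕ ⊖ c) (≈-trans (factor N T c) (difference-≈𝟘 same-value)) E₀≢0)
    where
    factor : ∀ n t c → (n ⊕ ⊖ t) ⊗ (n ⊕ t ⊕ ⊖ c) ≈ n ⊗ n ⊕ ⊖ (c ⊗ n) ⊕ ⊖ (t ⊗ t ⊕ ⊖ (c ⊗ t))
    factor = solve 3 (λ n t c → (n :- t) :* (n :+ t :- c) := n :* n :- c :* n :- (t :* t :- c :* t)) ≈-refl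

  1-x³ : Series
  1-x³ = 𝟙 ⊕ ⊖ x³

  1-x³-coefficients : ∀ n → 1-x³ n ≡ oneMinusX3 n
  1-x³-coefficients n = trans (cong (λ a → 𝟙 n + - a) (coeff x³≈ n)) (by-cases n)
    where
    by-cases : ∀ n → 𝟙 n + - shift (shift X) n ≡ oneMinusX3 n
    by-cases 0 = refl
    by-cases 1 = refl
    by-cases 2 = refl
    by-cases 3 = refl
    by-cases (suc (suc (suc (suc n)))) = refl

  Δ : Series
  Δ = 𝟙 ⊕ ⊖ (cst (+ 4) ⊗ x²) ⊕ ⊖ (cst (+ 2) ⊗ x³) ⊕ x³ ⊗ x³

  Δ-coefficients : ∀ n → Δ n ≡ disc n
  Δ-coefficients n = trans
    (cong₂ _+_ (cong₂ _+_ (cong (_+_ (𝟙 n)) (cong -_ (trans (cst-⊗ (+ 4) x² n) (cong (_*_ (+ 4)) (coeff (X-⊗ X) n)))))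
                          (cong -_ (trans (cst-⊗ (+ 2) x³ n) (cong (_*_ (+ 2)) (coeff x³≈ n)))))
               (trans (coeff (x³-⊗ x³) n) (coeff (shift-cong (shift-cong (shift-cong x³≈))) n)))
    (by-cases n)
    where
    by-cases : ∀ n → 𝟙 n + - (+ 4 * shift X n) + - (+ 2 * shift (shift X) n) + shift (shift (shift (shift (shift X)))) n ≡ disc n
    by-cases 0 = refl
    by-cases 1 = refl
    by-cases 2 = refl
    by-cases 3 = refl
    by-cases 4 = refl
    by-cases 5 = refl
    by-cases 6 = refl
    by-cases (suc (suc (suc (suc (suc (suc (suc n))))))) = refl

  T : Series
  T = cst (+ 2) ⊗ (x² ⊗ B)

  T-root : T ⊗ T ⊕ ⊖ (cst (+ 2) ⊗ 1-x³ ⊗ T) ≈ ⊖ (cst (+ 4) ⊗ x²)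
  T-root = ≈-from-difference (≈-trans (expand B X) (⊗-≈𝟘 (⊖ (cst (+ 4) ⊗ x²)) (difference-≈𝟘 B-inverse)))
    where
    expand : ∀ b x →
      let t = cst (+ 2) ⊗ (x ⊗ x ⊗ b) in
      t ⊗ t ⊕ ⊖ (cst (+ 2) ⊗ (𝟙 ⊕ ⊖ (x ⊗ (x ⊗ x))) ⊗ t) ⊕ ⊖ (⊖ (cst (+ 4) ⊗ (x ⊗ x)))
      ≈ ⊖ (cst (+ 4) ⊗ (x ⊗ x)) ⊗ (b ⊗ (𝟙 ⊕ ⊖ (x ⊗ (x ⊗ x)) ⊕ ⊖ (x ⊗ x ⊗ b)) ⊕ ⊖ 𝟙)
    expand = solve 2 (λ b x →
      let t = con (+ 2) :* (x :* x :* b) in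
      t :* t :- con (+ 2) :* (con 1ℤ :- x :* (x :* x)) :* t :- (:- (con (+ 4) :* (x :* x)))
      := (:- (con (+ 4) :* (x :* x))) :* (b :* (con 1ℤ :- x :* (x :* x) :- x :* x :* b) :- con 1ℤ)) ≈-refl

  numer-root : ∀ S → S ⊗ S ≈ Δ → numer S ⊗ numer S ⊕ ⊖ (cst (+ 2) ⊗ 1-x³ ⊗ numer S) ≈ ⊖ (cst (+ 4) ⊗ x²)
  numer-root S S²≈Δ = ≈-from-difference (≈-trans (expand S (numer S) X)
    (⊕-≈𝟘 (difference-≈𝟘 S²≈Δ) (⊗-≈𝟘 (⊖ (S ⊕ (1-x³ ⊕ ⊖ numer S))) (difference-≈𝟘 S≈1-x³-N))))
    where
    S≈1-x³-N : S ≈ 1-x³ ⊕ ⊖ numer S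
    S≈1-x³-N = coeffs λ n →
      trans (cancel (oneMinusX3 n) (S n)) (cong (λ a → a + - numer S n) (sym (1-x³-coefficients n)))
      where
      cancel : ∀ a s → s ≡ a + - (a + - s)
      cancel = solve-∀
    expand : ∀ s n x →
      let o = 𝟙 ⊕ ⊖ (x ⊗ (x ⊗ x)) in
      n ⊗ n ⊕ ⊖ (cst (+ 2) ⊗ o ⊗ n) ⊕ ⊖ (⊖ (cst (+ 4) ⊗ (x ⊗ x)))
      ≈ (s ⊗ s ⊕ ⊖ (𝟙 ⊕ ⊖ (cst (+ 4) ⊗ (x ⊗ x)) ⊕ ⊖ (cst (+ 2) ⊗ (x ⊗ (x ⊗ x))) ⊕ (x ⊗ (x ⊗ x)) ⊗ (x ⊗ (x ⊗ x))))
        ⊕ ⊖ (s ⊕ (o ⊕ ⊖ n)) ⊗ (s ⊕ ⊖ (o ⊕ ⊖ n))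
    expand = solve 3 (λ s n x →
      let o = con 1ℤ :- x :* (x :* x) in
      n :* n :- con (+ 2) :* o :* n :- (:- (con (+ 4) :* (x :* x)))
      := (s :* s :- (con 1ℤ :- con (+ 4) :* (x :* x) :- con (+ 2) :* (x :* (x :* x)) :+ (x :* (x :* x)) :* (x :* (x :* x))))
         :+ (:- (s :+ (o :- n))) :* (s :- (o :- n))) ≈-refl

  -- numer S and T are both roots of Y² − 2(1 − x³) Y + 4x², and both have constant term 0.
  numer≈T : ∀ S → S 0 ≡ 1ℤ → S ⊗ S ≈ Δ → numer S ≈ T
  numer≈T S S₀≡1 S²≈Δ =
    quadratic-root-unique (cst (+ 2) ⊗ 1-x³) (≈-trans (numer-root S S²≈Δ) (≈-sym T-root)) E₀≢0
    where
    E₀≢0 : (numer S ⊕ T ⊕ ⊖ (cst (+ 2) ⊗ 1-x³)) 0 ≢ 0ℤ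
    E₀≢0 rewrite S₀≡1 = λ ()

  T-coefficient : ∀ n → T (suc (suc n)) ≡ + 2 * B n
  T-coefficient n =
    trans (cst-⊗ (+ 2) (x² ⊗ B) (suc (suc n))) (cong (_*_ (+ 2)) (coeff (x²-⊗ B) (suc (suc n))))

  S-linear-term : ∀ S → S 0 ≡ 1ℤ → (S ⊛ S) 1 ≡ disc 1 → S 1 ≡ 0ℤ
  S-linear-term S S₀≡1 [S²]₁≡0 = *-cancelˡ-≡ (+ 2) (S 1) 0ℤ (begin
    + 2 * S 1                         ≡⟨ twice (S 1) ⟨
    1ℤ * S 1 + (S 1 * 1ℤ + 0ℤ)        ≡⟨ cong (λ a → a * S 1 + (S 1 * a + 0ℤ)) S₀≡1 ⟨
    (S ⊗ S) 1                         ≡⟨ ⊛≗⊗ S S 1 ⟨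
    (S ⊛ S) 1                         ≡⟨ [S²]₁≡0 ⟩
    0ℤ                                ≡⟨ *-zeroʳ (+ 2) ⟨
    + 2 * 0ℤ                          ∎)
    where
    twice : ∀ s → 1ℤ * s + (s * 1ℤ + 0ℤ) ≡ + 2 * s
    twice = solve-∀

open import Defs
open import Data.Nat using (ℕ; suc; _*_)
open import Data.Integer as ℤ using (ℤ)
open import Data.List using (List; length)
open import Data.List.Membership.Propositional using (_∈_)
open import Data.List.Relation.Unary.Unique.Propositional using (Unique)
open import Data.Product using (_×_)
open import Function.Bundles using (_⇔_)
open import Relation.Binary.PropositionalEquality using (_≡_)

open import Data.Integer using (+_) renaming (_*_ to _*ℤ_)
open import Data.Integer.Properties using (pos-*)
open import Data.Product using (_,_)
open import Relation.Binary.PropositionalEquality using (refl; sym; trans; cong; module ≡-Reasoning)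
open PowerSeries using (_⊗_; _≈_; coeffs; coeff; ⊛≗⊗)
open Enumerations using (enumeration)
open HeightCounts using (F-counts-H)
open GeneratingFunctions using (B)
open Quadratic using (Δ; Δ-coefficients; T; T-coefficient; numer≈T; S-linear-term)

theorem8 : (S : Series) → S 0 ≡ ℤ.+ 1 → (∀ n → (S ⊛ S) n ≡ disc n) →
    (numer S 0 ≡ ℤ.+ 0 × numer S 1 ≡ ℤ.+ 0) ×
    (∀ n (L : List (List Step)) → Unique L →
    (∀ γ → γ ∈ L ⇔ (H γ × length γ ≡ n)) →
    ℤ.+ (2 * length L) ≡ numer S (suc (suc n)))
theorem8 S S₀≡1 S²≡disc = (numer₀ , numer₁) , coefficients
  where
  numer₀ : numer S 0 ≡ + 0
  numer₀ rewrite S₀≡1 = refl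
  numer₁ : numer S 1 ≡ + 0
  numer₁ rewrite S-linear-term S S₀≡1 (S²≡disc 1) = refl
  S²≈Δ : S ⊗ S ≈ Δ
  S²≈Δ = coeffs λ n → trans (sym (⊛≗⊗ S S n)) (trans (S²≡disc n) (sym (Δ-coefficients n)))
  coefficients : ∀ n (L : List (List Step)) → Unique L → (∀ γ → γ ∈ L ⇔ (H γ × length γ ≡ n)) →
                 + (2 * length L) ≡ numer S (suc (suc n))
  coefficients n L L! L-members = begin
    + (2 * length L)             ≡⟨ pos-* 2 (length L) ⟩
    + 2 *ℤ + length L            ≡⟨ cong (λ k → + 2 *ℤ + k) (F-counts-H n (enumeration L L! L-members refl)) ⟩
    + 2 *ℤ B n                   ≡⟨ T-coefficient n ⟨
    T (suc (suc n))              ≡⟨ coeff (numer≈T S S₀≡1 S²≈Δ) (suc (suc n)) ⟨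
    numer S (suc (suc n))        ∎
    where open ≡-Reasoning
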